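{- For a measurable space $(X,\mathcal X)$, the flattening map $|\cdot|:X_{ee}\to X_e$, $\mathbf a_1\cdots\mathbf a_n\mapsto a_{11}\cdots a_{1k_1}\cdots a_{n1}\cdots a_{nk_n}$ (where $\mathbf a_i=a_{i1}\cdots a_{ik_i}$), is $(\mathcal X_{ee},\mathcal X_e)$-measurable.
   Context: For a set $X$, $X_e$ is the set of finite multisets $x_1\cdots x_n$ over $X$ (order irrelevant). For a measurable space $(X,\mathcal X)$, $\mathcal X_e$ is the $\sigma$-field on $X_e$ generated by the sets $A_1\cdots A_n=\{a_1\cdots a_n:a_i\in A_i\}$ with $A_i\in\mathcal X$, $n\ge0$. $X_{ee}=(X_e)_e$ (finite multisets of finite multisets) with $\sigma$-field $\mathcal X_{ee}=(\mathcal X_e)_e$. -}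

module Defs where

open import Level using (Level; 0ℓ) renaming (suc to lsuc)
open import Data.Nat using (ℕ)
open import Data.Product using (Σ; ∃; _×_)
open import Data.Unit using (⊤)
open import Data.Empty using (⊥)
open import Data.List using (List; concat)
open import Data.List.Relation.Unary.All using (All)
open import Data.List using ([]; _∷_)
open import Data.List.Relation.Binary.Permutation.Propositional using (_↭_)
open import Relation.Nullary using (¬_)

Subset : Set → Set₁
Subset X = X → Set

_≐_ : {X : Set} → Subset X → Subset X → Set
A ≐ B = ∀ x → (A x → B x) × (B x → A x)

record SigmaField (X : Set) : Set₂ where
  field
    Meas   : Subset X → Set₁
    ext    : ∀ {A B} → A ≐ B → Meas A → Meas B
    univ   : Meas (λ _ → ⊤)
    compl  : ∀ {A} → Meas A → Meas (λ x → ¬ A x)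
    union  : (A : ℕ → Subset X) → (∀ n → Meas (A n)) → Meas (λ x → ∃ λ n → A n x)
open SigmaField public

InEach : {X : Set} → List (Subset X) → List X → Set
InEach []       []       = ⊤
InEach (A ∷ As) (x ∷ xs) = A x × InEach As xs
InEach _        _        = ⊥

-- Finite multisets over X are represented by lists, considered up to
-- permutation (_↭_).  The set A₁⋯Aₙ = {a₁⋯aₙ : aᵢ ∈ Aᵢ}:
Box : {X : Set} → List (Subset X) → Subset (List X)
Box As l = ∃ λ l′ → (l′ ↭ l) × InEach As l′

data GenE {X : Set} (𝒳 : SigmaField X) : Subset (List X) → Set₁ where
  gen   : (As : List (Subset X)) → All (Meas 𝒳) As → GenE 𝒳 (Box As)
  ext′  : ∀ {A B} → A ≐ B → GenE 𝒳 A → GenE 𝒳 B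
  univ′ : GenE 𝒳 (λ _ → ⊤)
  compl′ : ∀ {A} → GenE 𝒳 A → GenE 𝒳 (λ x → ¬ A x)
  union′ : (A : ℕ → Subset (List X)) → (∀ n → GenE 𝒳 (A n)) →
           GenE 𝒳 (λ x → ∃ λ n → A n x)

_ₑ : {X : Set} → SigmaField X → SigmaField (List X)
𝒳 ₑ = record
  { Meas = GenE 𝒳 ; ext = ext′ ; univ = univ′ ; compl = compl′ ; union = union′ }

Measurable : {X Y : Set} → SigmaField X → SigmaField Y → (X → Y) → Set₁
Measurable {X} {Y} 𝒳 𝒴 f = (B : Subset Y) → Meas 𝒴 B → Meas 𝒳 (λ x → B (f x))

flatten : {X : Set} → List (List X) → List X
flatten = concat

-- A map into X_e is measurable as soon as the preimages of the generators
-- A₁⋯Aₙ are.  A multiset of blocks flattens into A₁⋯Aₙ exactly when, after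
-- reordering the Aᵢ, its blocks lie in consecutive groups of them; so the
-- preimage of A₁⋯Aₙ is the union, over the countably many reorderings and
-- cut positions, of generators (A_{σ1}⋯A_{σk₁})⋯(⋯A_{σn}) of 𝒳_ee, together
-- with the empty multiset when n = 0.
module Submission where

open import Defs
open import Level using (Level)
open import Data.Nat using (ℕ; zero; suc)
open import Data.Nat.Properties using (suc-injective)
open import Data.Product using (∃; _×_; _,_)
open import Data.Sum using (_⊎_; inj₁; inj₂)
open import Data.Unit using (tt)
open import Data.Empty using (⊥-elim)
open import Data.List using (List; []; _∷_; _++_; concat; map; take; drop; length; [_])
open import Data.List.Properties using (take++drop≡id; ++-identityʳ)
open import Data.List.Relation.Unary.All as All using (All)
open import Data.List.Relation.Unary.All.Properties using (concat⁻; map⁺)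
open import Data.List.Relation.Unary.Any using (here)
open import Data.List.Relation.Binary.Permutation.Propositional
open import Data.List.Relation.Binary.Permutation.Propositional.Properties
  using (↭-empty-inv; ++⁺; ++⁺ˡ; shifts; ∈-resp-↭; drop-mid; All-resp-↭)
open import Data.List.Membership.Propositional.Properties using (∈-∃++)
open import Relation.Nullary using (¬_)
open import Relation.Binary.PropositionalEquality as ≡ using (_≡_; refl; cong; subst)

module _ {Y : Set} (S : SigmaField Y) where

  Meas-∪ : ∀ {A B} → Meas S A → Meas S B → Meas S (λ y → A y ⊎ B y)
  Meas-∪ {A} {B} mA mB = ext S split-index (union S F mF)
    where
    F : ℕ → Subset Y
    F zero    = A
    F (suc _) = B

    mF : ∀ n → Meas S (F n)
    mF zero    = mA
    mF (suc _) = mB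

    split-index : (λ y → ∃ λ n → F n y) ≐ (λ y → A y ⊎ B y)
    split-index y = (λ { (zero , a) → inj₁ a ; (suc _ , b) → inj₂ b })
                  , (λ { (inj₁ a) → 0 , a ; (inj₂ b) → 1 , b })

  Meas-⋃-length : ∀ n (F : List ℕ → Subset Y) → (∀ is → Meas S (F is)) →
                  Meas S (λ y → ∃ λ is → length is ≡ n × F is y)
  Meas-⋃-length zero F mF = ext S only-nil (mF [])
    where
    only-nil : F [] ≐ (λ y → ∃ λ is → length is ≡ 0 × F is y)
    only-nil y = (λ f → [] , refl , f) , λ { ([] , _ , f) → f }
  Meas-⋃-length (suc n) F mF =
    ext S by-head (union S (λ i y → ∃ λ is → length is ≡ n × F (i ∷ is) y)
                           (λ i → Meas-⋃-length n (λ is → F (i ∷ is)) (λ is → mF (i ∷ is))))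
    where
    by-head : (λ y → ∃ λ i → ∃ λ is → length is ≡ n × F (i ∷ is) y)
            ≐ (λ y → ∃ λ is → length is ≡ suc n × F is y)
    by-head y = (λ { (i , is , e , f) → i ∷ is , cong suc e , f })
              , (λ { ((i ∷ is) , e , f) → i , is , suc-injective e , f })

  Meas-⋃-List : (F : List ℕ → Subset Y) → (∀ is → Meas S (F is)) →
                Meas S (λ y → ∃ λ is → F is y)
  Meas-⋃-List F mF = ext S by-length (union S _ (λ n → Meas-⋃-length n F mF))
    where
    by-length : (λ y → ∃ λ n → ∃ λ is → length is ≡ n × F is y) ≐ (λ y → ∃ λ is → F is y)
    by-length y = (λ { (_ , is , _ , f) → is , f })
                , (λ { (is , f) → length is , is , refl , f })

  Meas-⋃-List² : (F : List ℕ × List ℕ → Subset Y) → (∀ p → Meas S (F p)) →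
                 Meas S (λ y → ∃ λ p → F p y)
  Meas-⋃-List² F mF =
    ext S curried (Meas-⋃-List _ (λ is → Meas-⋃-List _ (λ js → mF (is , js))))
    where
    curried : (λ y → ∃ λ is → ∃ λ js → F (is , js) y) ≐ (λ y → ∃ λ p → F p y)
    curried y = (λ { (is , js , f) → (is , js) , f }) , λ { ((is , js) , f) → is , js , f }

Box-preimages⇒Measurable : {X Y : Set} {𝒳 : SigmaField X} (S : SigmaField Y)
                           (f : Y → List X) →
                           (∀ As → All (Meas 𝒳) As → Meas S (λ y → Box As (f y))) →
                           Measurable S (𝒳 ₑ) f
Box-preimages⇒Measurable S f meas-Box B = preimage
  where
  preimage : ∀ {B} → GenE _ B → Meas S (λ y → B (f y))
  preimage (gen As mAs)  = meas-Box As mAs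
  preimage (ext′ eq m)   = ext S (λ y → eq (f y)) (preimage m)
  preimage univ′         = univ S
  preimage (compl′ m)    = compl S (preimage m)
  preimage (union′ A mA) = union S _ (λ n → preimage (mA n))

module _ {a : Level} {A : Set a} where

  insert : ℕ → A → List A → List A
  insert zero    x ys       = x ∷ ys
  insert (suc i) x []       = [ x ]
  insert (suc i) x (y ∷ ys) = y ∷ insert i x ys

  insert-↭ : ∀ i x ys → insert i x ys ↭ x ∷ ys
  insert-↭ zero    x ys       = refl
  insert-↭ (suc i) x []       = refl
  insert-↭ (suc i) x (y ∷ ys) = trans (prep y (insert-↭ i x ys)) (swap y x refl)

  insert-length : ∀ x as bs → insert (length as) x (as ++ bs) ≡ as ++ x ∷ bs
  insert-length x []       bs = refl
  insert-length x (a ∷ as) bs = cong (a ∷_) (insert-length x as bs)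

  -- A list of insertion positions encodes a rearrangement, so that
  -- rearrangements are indexed by the countable set List ℕ.
  permute : List ℕ → List A → List A
  permute []       xs       = xs
  permute (i ∷ is) []       = []
  permute (i ∷ is) (x ∷ xs) = insert i x (permute is xs)

  permute-↭ : ∀ is xs → permute is xs ↭ xs
  permute-↭ []       xs       = refl
  permute-↭ (i ∷ is) []       = refl
  permute-↭ (i ∷ is) (x ∷ xs) = trans (insert-↭ i x _) (prep x (permute-↭ is xs))

  permute-surjective : ∀ xs {ys} → ys ↭ xs → ∃ λ is → permute is xs ≡ ys
  permute-surjective [] p = [] , ≡.sym (↭-empty-inv p)
  permute-surjective (x ∷ xs) p with ∈-∃++ (∈-resp-↭ (↭-sym p) (here refl))
  ... | as , bs , refl with permute-surjective xs (drop-mid as [] p)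
  ... | is , e =
    length as ∷ is , ≡.trans (cong (insert (length as) x) e) (insert-length x as bs)

  concat-↭ : ∀ {xss yss : List (List A)} → xss ↭ yss → concat xss ↭ concat yss
  concat-↭ refl           = refl
  concat-↭ (prep xs p)    = ++⁺ˡ xs (concat-↭ p)
  concat-↭ (swap xs ys p) = trans (shifts xs ys) (++⁺ˡ ys (++⁺ˡ xs (concat-↭ p)))
  concat-↭ (trans p q)    = trans (concat-↭ p) (concat-↭ q)

  -- The last block takes whatever remains, so no cut sequence loses elements.
  split : List ℕ → List A → List (List A)
  split []       xs = [ xs ]
  split (n ∷ ns) xs = take n xs ∷ split ns (drop n xs)

  concat-split : ∀ ns xs → concat (split ns xs) ≡ xs
  concat-split []       xs = ++-identityʳ xs
  concat-split (n ∷ ns) xs rewrite concat-split ns (drop n xs) = take++drop≡id n xs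

  All-split : ∀ {p} {P : A → Set p} ns {xs} → All P xs → All (All P) (split ns xs)
  All-split ns {xs} pxs = concat⁻ (subst (All _) (≡.sym (concat-split ns xs)) pxs)

module _ {X : Set} where

  InEach-++ : ∀ {As Bs : List (Subset X)} {l m} → InEach As l → InEach Bs m →
              InEach (As ++ Bs) (l ++ m)
  InEach-++ {[]}    {l = []}    _       q = q
  InEach-++ {_ ∷ _} {l = _ ∷ _} (a , p) q = a , InEach-++ p q

  InEach-++⁻ : ∀ (As : List (Subset X)) l {m} → InEach As (l ++ m) →
               InEach (take (length l) As) l × InEach (drop (length l) As) m
  InEach-++⁻ As       []      p       = tt , p
  InEach-++⁻ (_ ∷ As) (_ ∷ l) (a , p) with InEach-++⁻ As l p
  ... | q , r = (a , q) , r

  InEach-↭ˡ : ∀ {As′ As : List (Subset X)} → As′ ↭ As → ∀ {l} → InEach As′ l →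
              ∃ λ l′ → l′ ↭ l × InEach As l′
  InEach-↭ˡ refl          {l}         p           = l , refl , p
  InEach-↭ˡ (prep _ q)    {x ∷ _}     (a , p)     with InEach-↭ˡ q p
  ... | l′ , r , p′ = x ∷ l′ , prep x r , a , p′
  InEach-↭ˡ (swap _ _ q)  {x ∷ y ∷ _} (a , b , p) with InEach-↭ˡ q p
  ... | l′ , r , p′ = y ∷ x ∷ l′ , swap y x r , b , a , p′
  InEach-↭ˡ (trans q₁ q₂) p           with InEach-↭ˡ q₁ p
  ... | l₁ , r₁ , p₁ with InEach-↭ˡ q₂ p₁
  ... | l₂ , r₂ , p₂ = l₂ , trans r₂ r₁ , p₂

  InEach-↭ʳ : ∀ {l l′ : List X} → l ↭ l′ → ∀ {As} → InEach As l →
              ∃ λ As′ → As′ ↭ As × InEach As′ l′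
  InEach-↭ʳ refl          {As}        p           = As , refl , p
  InEach-↭ʳ (prep _ q)    {A ∷ _}     (a , p)     with InEach-↭ʳ q p
  ... | As′ , r , p′ = A ∷ As′ , prep A r , a , p′
  InEach-↭ʳ (swap _ _ q)  {A ∷ B ∷ _} (a , b , p) with InEach-↭ʳ q p
  ... | As′ , r , p′ = B ∷ A ∷ As′ , swap B A r , b , a , p′
  InEach-↭ʳ (trans q₁ q₂) p           with InEach-↭ʳ q₁ p
  ... | A₁ , r₁ , p₁ with InEach-↭ʳ q₂ p₁
  ... | A₂ , r₂ , p₂ = A₂ , trans r₂ r₁ , p₂

  InEach⇒Box : ∀ {As : List (Subset X)} {l} → InEach As l → Box As l
  InEach⇒Box {l = l} p = l , refl , p

  Box-resp-↭ : ∀ {As′ As : List (Subset X)} {l} → As′ ↭ As → Box As′ l → Box As l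
  Box-resp-↭ q (l′ , r , p) with InEach-↭ˡ q p
  ... | l″ , r′ , p′ = l″ , trans r′ r , p′

  ¬Box-∷-[] : ∀ {A} {As : List (Subset X)} → ¬ Box (A ∷ As) []
  ¬Box-∷-[] (l , r , p) with ↭-empty-inv r
  ¬Box-∷-[] (.[] , r , ()) | refl

  InEach-Box-concat : ∀ {Bss : List (List (Subset X))} {L} → InEach (map Box Bss) L →
                      Box (concat Bss) (concat L)
  InEach-Box-concat {[]}    {[]}    _ = [] , refl , tt
  InEach-Box-concat {_ ∷ _} {_ ∷ _} ((l , r , p) , q) with InEach-Box-concat q
  ... | l′ , r′ , p′ = l ++ l′ , ++⁺ r r′ , InEach-++ p p′

  Box-concat : ∀ {Bss : List (List (Subset X))} {L} → Box (map Box Bss) L →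
               Box (concat Bss) (concat L)
  Box-concat (L′ , R , P) with InEach-Box-concat P
  ... | l , r , p = l , trans r (concat-↭ R) , p

  InEach-concat⇒split : ∀ (As : List (Subset X)) m L → InEach As (concat (m ∷ L)) →
                        ∃ λ ns → InEach (map Box (split ns As)) (m ∷ L)
  InEach-concat⇒split As m []       p =
    [] , InEach⇒Box (subst (InEach As) (++-identityʳ m) p) , tt
  InEach-concat⇒split As m (m′ ∷ L) p with InEach-++⁻ As m p
  ... | q , r with InEach-concat⇒split (drop (length m) As) m′ L r
  ... | ns , s = length m ∷ ns , InEach⇒Box q , s

module _ {X : Set} where

  regroup : List ℕ × List ℕ → List (Subset X) → List (Subset (List X))
  regroup (is , ns) As = map Box (split ns (permute is As))

  -- For n = 0 the empty multiset of blocks, which no regrouping produces,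
  -- also flattens into A₁⋯Aₙ.
  Regrouped : List (Subset X) → Subset (List (List X))
  Regrouped []       L = Box [] L ⊎ ∃ λ p → Box (regroup p []) L
  Regrouped (A ∷ As) L = ∃ λ p → Box (regroup p (A ∷ As)) L

  regroup-sound : ∀ p As {L} → Box (regroup p As) L → Box As (concat L)
  regroup-sound (is , ns) As q =
    Box-resp-↭ (permute-↭ is As)
      (subst (λ Bs → Box Bs _) (concat-split ns (permute is As)) (Box-concat q))

  regroup-complete : ∀ As {m L} → Box As (concat (m ∷ L)) →
                     ∃ λ p → Box (regroup p As) (m ∷ L)
  regroup-complete As {m} {L} (l , r , p) with InEach-↭ʳ r p
  ... | As′ , r′ , p′ with permute-surjective As r′ | InEach-concat⇒split As′ m L p′
  ... | is , refl | ns , s = (is , ns) , InEach⇒Box s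

  Regrouped-≐ : ∀ As → Regrouped As ≐ (λ L → Box As (concat L))
  Regrouped-≐ []       L =
    (λ { (inj₁ q) → Box-concat {Bss = []} q ; (inj₂ (p , q)) → regroup-sound p [] q }) , flattens L
    where
    flattens : ∀ L → Box [] (concat L) → Regrouped [] L
    flattens []      _ = inj₁ ([] , refl , tt)
    flattens (_ ∷ _) q = inj₂ (regroup-complete [] q)
  Regrouped-≐ (A ∷ As) L =
    (λ { (p , q) → regroup-sound p (A ∷ As) q }) , flattens L
    where
    flattens : ∀ L → Box (A ∷ As) (concat L) → Regrouped (A ∷ As) L
    flattens []      q = ⊥-elim (¬Box-∷-[] q)
    flattens (_ ∷ _) q = regroup-complete (A ∷ As) q

  module _ (𝒳 : SigmaField X) where

    regroup-measurable : ∀ p {As} → All (Meas 𝒳) As → All (Meas (𝒳 ₑ)) (regroup p As)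
    regroup-measurable (is , ns) {As} mAs =
      map⁺ (All.map (λ {Bs} → gen Bs) (All-split ns (All-resp-↭ (↭-sym (permute-↭ is As)) mAs)))

    regroupings-measurable : ∀ {As} → All (Meas 𝒳) As →
                             Meas ((𝒳 ₑ) ₑ) (λ L → ∃ λ p → Box (regroup p As) L)
    regroupings-measurable mAs = Meas-⋃-List² ((𝒳 ₑ) ₑ) _ (λ p → gen _ (regroup-measurable p mAs))

    Regrouped-measurable : ∀ As → All (Meas 𝒳) As → Meas ((𝒳 ₑ) ₑ) (Regrouped As)
    Regrouped-measurable []       mAs = Meas-∪ ((𝒳 ₑ) ₑ) (gen [] All.[]) (regroupings-measurable mAs)
    Regrouped-measurable (A ∷ As) mAs = regroupings-measurable mAs

lemma3p16 : {X : Set} (𝒳 : SigmaField X) → Measurable ((𝒳 ₑ) ₑ) (𝒳 ₑ) flatten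
lemma3p16 𝒳 = Box-preimages⇒Measurable ((𝒳 ₑ) ₑ) flatten λ As mAs →
  ext ((𝒳 ₑ) ₑ) (Regrouped-≐ As) (Regrouped-measurable 𝒳 As mAs)
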